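{- For all $d\ge0$ and all integers $j$ with $\frac{d+1}{2}<j\le d+1$, the polynomial $A_j(d+1,t)=\sum_{i=0}^dh_it^i$ is alternatingly increasing, i.e. $h_0\le h_d\le h_1\le h_{d-1}\le\cdots\le h_{\lfloor\frac{d+1}{2}\rfloor}$.
   Context: For $\sigma\in S_m$, $\operatorname{des}(\sigma)=|\{i\in[m-1]:\sigma_i>\sigma_{i+1}\}|$, and for $1\le j\le m$, $A_j(m,t)=\sum_{\sigma\in S_m,\ \sigma_m=m+1-j}t^{\operatorname{des}(\sigma)}$. A polynomial $\sum_{i=0}^dh_it^i$ (considered with index range $0,\dots,d$) is alternatingly increasing if $h_0\le h_d\le h_1\le h_{d-1}\le\cdots\le h_{\lfloor\frac{d+1}{2}\rfloor}$. -}

module Defs where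

open import Data.Nat using (ℕ; zero; suc; _+_; _*_; _∸_; _≤_; _<_; _≟_)
open import Data.Nat.Properties using (<-cmp)
open import Data.Fin using (Fin; toℕ)
import Data.Fin.Properties as FinP
open import Data.Fin using (_<?_)
open import Data.Bool using (true; false; if_then_else_)
open import Data.List using (List; []; _∷_; map; concatMap; filter; length; allFin)
open import Data.Vec using (Vec; []; _∷_; toList; last)
open import Data.Product using (_×_)
open import Relation.Nullary using (does)
open import Relation.Nullary.Decidable using (_×-dec_)
import Data.List.Relation.Unary.Unique.DecPropositional as UniqueDec

words : (k m : ℕ) → List (Vec (Fin m) k)
words zero    m = [] ∷ []
words (suc k) m = concatMap (λ x → map (x ∷_) (words k m)) (allFin m)

-- The symmetric group S_m, realised as the list of all words σ = σ_1 … σ_m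
-- over the alphabet {0,…,m-1} (Fin m) with pairwise distinct letters,
-- i.e. the one-line notations of the permutations of [m] (shifted by -1).
perms : (m : ℕ) → List (Vec (Fin m) m)
perms m = filter (λ σ → UniqueDec.unique? FinP._≟_ (toList σ)) (words m m)

des : ∀ {m k} → Vec (Fin m) k → ℕ
des []           = 0
des (x ∷ [])     = 0
des (x ∷ ys@(y ∷ _)) = (if does (y <? x) then 1 else 0) + des ys

-- Coefficient of t^i in A_j(m+1, t) (here m+1 plays the role of m in the
-- paper, so that the last letter exists):  the number of σ ∈ S_{m+1} with
-- σ_{m+1} = (m+1)+1-j  (i.e. 0-based last letter  (m+1) ∸ j) and des σ = i.
Acoeff : (m j i : ℕ) → ℕ
Acoeff m j i =
  length (filter (λ σ → (toℕ (last σ) ≟ (suc m ∸ j)) ×-dec (des σ ≟ i)) (perms (suc m)))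

-- A polynomial Σ_{i=0}^d h_i t^i is alternatingly increasing:
-- h_0 ≤ h_d ≤ h_1 ≤ h_{d-1} ≤ … ≤ h_{⌊(d+1)/2⌋}, i.e. for every i,
-- h_i ≤ h_{d-i} whenever 2i+1 ≤ d, and h_{d-i} ≤ h_{i+1} whenever 2i+2 ≤ d.
AltIncreasing : (d : ℕ) → (ℕ → ℕ) → Set
AltIncreasing d h =
  ∀ i → (suc (2 * i) ≤ d → h i ≤ h (d ∸ i))
      × (suc (suc (2 * i)) ≤ d → h (d ∸ i) ≤ h (suc i))

module Submission where

-- Let E n s i (refinedEulerian) count the permutations of {0, …, n} ending in s with i descents;
-- the theorem concerns E d s for s = d+1-j, where the hypothesis on j reads 2 s ≤ d.
-- Deleting the last letter gives E (n+1) s = Σ_{r ≤ n} t^[s ≤ r] · E n r, and reverse-complement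
-- gives E n s i = E n (n-s) (n-i).  For s̄ = n+1-s ≥ s the alternating inequalities of E (n+1) s
-- therefore reduce to E (n+1) s i ≤ E (n+1) s̄ i ≤ E (n+1) s (i+1).  Both follow by pairing the
-- summands r and n-r, which differ between the two sides only in carrying the factor t: for the
-- one of r, n-r that is at most n/2, E n r is alternatingly increasing by induction, which makes
-- E n r + rev (E n r) and E n r + t · rev (E n r) increase up to the middle degree.

open import Defs
open import Data.Nat using (ℕ; zero; suc; _+_; _*_; _∸_; _≤_; _<_; z≤n; s≤s; s≤s⁻¹; _≤?_; _<?_; _≟_)
open import Data.Nat.Properties
  using ( +-suc; +-comm; +-assoc; +-identityʳ; *-identityˡ; *-zeroʳ; *-assoc; *-comm; *-suc
        ; suc-injective; ≤-refl; ≤-reflexive; ≤-trans; <-≤-trans; ≤-total; <⇒≤; <⇒≱; ≰⇒>; ≮⇒≥; ≤∧≮⇒≡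
        ; m≤m+n; m∸n≤m; m+[n∸m]≡n; m∸n+n≡m; m+n∸m≡n; *-distribˡ-∸; ∸-monoʳ-≤
        ; +-mono-≤; +-monoˡ-≤; +-monoʳ-≤; +-cancelˡ-≤; *-cancelˡ-≤
        ; +-*-semiring; module ≤-Reasoning )
open import Data.Nat.ListAction using () renaming (sum to sumˡ)
open import Data.Nat.ListAction.Properties using (sum-++)
open import Data.Bool using (Bool; true; false; _∧_; not; if_then_else_)
open import Data.Bool.Properties using (∧-assoc; ∧-zeroʳ; ∧-identityʳ; ∧-commutativeMonoid)
open import Data.Bool.ListAction using (all)
open import Data.Fin using (Fin; zero; suc; toℕ; fromℕ<)
import Data.Fin as Fin using (_≟_; _<?_)
open import Data.Fin.Properties using (toℕ<n; toℕ-injective; toℕ-fromℕ<; opposite-prop)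
open import Data.Fin.Permutation using (reverse)
open import Data.Fin.Subset using (Subset; _-_; _─_; ∣_∣; ⊤; ⊥)
open import Data.Fin.Subset.Properties using (p─⊥≡p; p─x─y≡p─y─x; ∣⊤∣≡n)
open import Data.Vec using (Vec; []; _∷_; _∷ʳ_; last; lookup; toList)
open import Data.Vec.Properties using (last-∷ʳ; lookup-replicate)
open import Data.List using (List; []; _∷_; map; filter; length; concatMap; tabulate)
open import Data.List.Properties using (map-++; map-∘)
open import Data.List.Relation.Unary.All using (all?)
import Data.List.Relation.Unary.Unique.DecPropositional as UniqueDec
open import Data.List.Relation.Unary.Unique.Propositional using (Unique)
open import Data.Product using (_×_; _,_; proj₁; proj₂)
open import Data.Sum using (inj₁; inj₂)
open import Function using (_∘_)
open import Function.Bundles using (_⇔_; mk⇔)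
open import Relation.Nullary using (does; yes; no)
open import Relation.Nullary.Decidable using (dec-true; dec-false; does-⇔; ¬?; _×-dec_)
open import Relation.Unary using (Decidable)
open import Relation.Binary.PropositionalEquality
open import Algebra.Bundles using (CommutativeMonoid)
open import Algebra.Properties.CommutativeSemigroup (CommutativeMonoid.commutativeSemigroup ∧-commutativeMonoid)
  using (interchange; x∙yz≈y∙xz)
open import Algebra.Properties.Semiring.Sum +-*-semiring
  using (sum; sum-syntax; sum-cong-≗; sum-replicate-zero; ∑-permute; ∑-distrib-+; ∑-comm; *-distribˡ-sum)

complement-≤ : ∀ {a ā b b̄} → a + ā ≡ b + b̄ → a ≤ b → b̄ ≤ ā
complement-≤ {a} {ā} {b} {b̄} sums≡ a≤b =
  +-cancelˡ-≤ b b̄ ā (≤-trans (≤-reflexive (sym sums≡)) (+-monoˡ-≤ ā a≤b))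

swap-sum : ∀ x {y z} → x + y ≡ z → y + x ≡ z
swap-sum x {y} = trans (+-comm y x)

minus-from-sum : ∀ {a b d} → a + b ≡ d → d ∸ a ≡ b
minus-from-sum {a} {b} a+b≡d = trans (cong (_∸ a) (sym a+b≡d)) (m+n∸m≡n a b)

2*n≡n+n : ∀ n → 2 * n ≡ n + n
2*n≡n+n n = cong (n +_) (+-identityʳ n)

double≤sum : ∀ {r r̄ n} → r ≤ r̄ → r + r̄ ≡ n → 2 * r ≤ n
double≤sum {r} r≤r̄ r+r̄ =
  ≤-trans (≤-reflexive (2*n≡n+n r)) (≤-trans (+-monoʳ-≤ r r≤r̄) (≤-reflexive r+r̄))

𝟙 : Bool → ℕ
𝟙 b = if b then 1 else 0

𝟙-∧ : ∀ x y → 𝟙 (x ∧ y) ≡ 𝟙 x * 𝟙 y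
𝟙-∧ true  y = sym (*-identityˡ (𝟙 y))
𝟙-∧ false y = refl

∑-zero : ∀ {n} {f : Fin n → ℕ} → (∀ r → f r ≡ 0) → sum f ≡ 0
∑-zero {n} f≡0 = trans (sum-cong-≗ f≡0) (sum-replicate-zero n)

∑-mono-≤ : ∀ {n} {f g : Fin n → ℕ} → (∀ r → f r ≤ g r) → sum f ≤ sum g
∑-mono-≤ {zero}  _   = z≤n
∑-mono-≤ {suc n} f≤g = +-mono-≤ (f≤g zero) (∑-mono-≤ (f≤g ∘ suc))

∑-delta : ∀ {M} (c : Fin M) (g : Fin M → ℕ) → ∑[ x < M ] (𝟙 (does (x Fin.≟ c)) * g x) ≡ g c
∑-delta {suc M} zero    g = trans (cong₂ _+_ (*-identityˡ (g zero)) (∑-zero {M} (λ _ → refl)))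
                                  (+-identityʳ (g zero))
∑-delta {suc M} (suc c) g = ∑-delta c (g ∘ suc)

∑-reverse : ∀ m (f : ℕ → ℕ) → ∑[ q < m ] f (toℕ q) ≡ ∑[ q < m ] f (m ∸ suc (toℕ q))
∑-reverse m f = trans (∑-permute {m} (f ∘ toℕ) reverse) (sum-cong-≗ {m} (cong f ∘ opposite-prop))

toℕ-complement : ∀ {m} (q : Fin m) → suc (toℕ q + (m ∸ suc (toℕ q))) ≡ m
toℕ-complement q = m+[n∸m]≡n (toℕ<n q)

∑-reflect : ∀ m {f g : ℕ → ℕ} → (∀ {q q̄} → suc (q + q̄) ≡ m → f q ≡ g q̄) →
            ∑[ q < m ] f (toℕ q) ≡ ∑[ q < m ] g (toℕ q)
∑-reflect m {f} {g} f≡g =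
  trans (sum-cong-≗ (λ q → f≡g (toℕ-complement q))) (sym (∑-reverse m g))

∑-mono-paired : ∀ m {f g : ℕ → ℕ} →
                (∀ {q q̄} → suc (q + q̄) ≡ m → f q + f q̄ ≤ g q + g q̄) →
                ∑[ q < m ] f (toℕ q) ≤ ∑[ q < m ] g (toℕ q)
∑-mono-paired m {f} {g} pair≤ = *-cancelˡ-≤ 2 (begin
  2 * ∑f                                  ≡⟨ 2*n≡n+n ∑f ⟩
  ∑f + ∑f                                 ≡⟨ cong (∑f +_) (∑-reverse m f) ⟩
  ∑f + ∑[ q < m ] f (op q)                ≡⟨ ∑-distrib-+ {m} (f ∘ toℕ) (f ∘ op) ⟨
  ∑[ q < m ] (f (toℕ q) + f (op q))       ≤⟨ ∑-mono-≤ (λ q → pair≤ (toℕ-complement q)) ⟩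
  ∑[ q < m ] (g (toℕ q) + g (op q))       ≡⟨ ∑-distrib-+ {m} (g ∘ toℕ) (g ∘ op) ⟩
  ∑g + ∑[ q < m ] g (op q)                ≡⟨ cong (∑g +_) (∑-reverse m g) ⟨
  ∑g + ∑g                                 ≡⟨ 2*n≡n+n ∑g ⟨
  2 * ∑g                                  ∎)
  where
  open ≤-Reasoning
  op : Fin m → ℕ
  op q = m ∸ suc (toℕ q)
  ∑f ∑g : ℕ
  ∑f = ∑[ q < m ] f (toℕ q)
  ∑g = ∑[ q < m ] g (toℕ q)

-- Coefficient sequences ℕ → ℕ stand for polynomials in t; shift g is t · g.
shift : (ℕ → ℕ) → ℕ → ℕ
shift g zero    = 0
shift g (suc i) = g i

shiftIf : Bool → (ℕ → ℕ) → ℕ → ℕ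
shiftIf false g = g
shiftIf true  g = shift g

shiftIf-cong : ∀ b {g g′ : ℕ → ℕ} i → (∀ j → g j ≡ g′ j) → shiftIf b g i ≡ shiftIf b g′ i
shiftIf-cong false i       g≡g′ = g≡g′ i
shiftIf-cong true  zero    g≡g′ = refl
shiftIf-cong true  (suc i) g≡g′ = g≡g′ i

shiftIf-*ˡ : ∀ c b (g : ℕ → ℕ) i → shiftIf b (λ j → c * g j) i ≡ c * shiftIf b g i
shiftIf-*ˡ c false g i       = refl
shiftIf-*ˡ c true  g zero    = sym (*-zeroʳ c)
shiftIf-*ˡ c true  g (suc i) = refl

shiftIf-vanishes : ∀ {n} {g : ℕ → ℕ} → (∀ {j} → n < j → g j ≡ 0) →
                   ∀ b {i} → suc n < i → shiftIf b g i ≡ 0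
shiftIf-vanishes g≡0 false       n+1<i = g≡0 (<⇒≤ n+1<i)
shiftIf-vanishes g≡0 true {suc i} n+1<i = g≡0 (s≤s⁻¹ n+1<i)

-- Alternatingly increasing sequences

Reverse : ℕ → (ℕ → ℕ) → (ℕ → ℕ) → Set
Reverse d h g = ∀ {j j̄} → j + j̄ ≡ d → g j ≡ h j̄

AltIncreasing-cong : ∀ {d} {g h : ℕ → ℕ} → (∀ i → g i ≡ h i) →
                     AltIncreasing d h → AltIncreasing d g
AltIncreasing-cong {d} g≡h alt i =
  (λ 2i<d → subst₂ _≤_ (sym (g≡h i)) (sym (g≡h (d ∸ i))) (proj₁ (alt i) 2i<d)) ,
  (λ 2i+1<d → subst₂ _≤_ (sym (g≡h (d ∸ i))) (sym (g≡h (suc i))) (proj₂ (alt i) 2i+1<d))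

module _ {d} {h : ℕ → ℕ} (alt : AltIncreasing d h) where

  AltIncreasing-lower : ∀ {k} → suc (2 * k) ≤ d → h k ≤ h (suc k)
  AltIncreasing-lower {k} 2k<d with suc (suc (2 * k)) ≤? d
  ... | yes 2k+1<d = ≤-trans (proj₁ (alt k) 2k<d) (proj₂ (alt k) 2k+1<d)
  ... | no  2k+1≮d = ≤-trans (proj₁ (alt k) 2k<d) (≤-reflexive (cong h d∸k≡k+1))
    where
    d∸k≡k+1 : d ∸ k ≡ suc k
    d∸k≡k+1 = minus-from-sum (trans (+-suc k k)
                (trans (cong suc (sym (2*n≡n+n k))) (≤∧≮⇒≡ 2k<d 2k+1≮d)))

  AltIncreasing-upper : ∀ {k} → suc (suc (2 * k)) ≤ d → h (d ∸ k) ≤ h (d ∸ suc k)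
  AltIncreasing-upper {k} 2k+1<d with suc (2 * suc k) ≤? d
  ... | yes 2k+2<d = ≤-trans (proj₂ (alt k) 2k+1<d) (proj₁ (alt (suc k)) 2k+2<d)
  ... | no  2k+2≮d = ≤-trans (proj₂ (alt k) 2k+1<d) (≤-reflexive (cong h (sym d∸[k+1]≡k+1)))
    where
    d∸[k+1]≡k+1 : d ∸ suc k ≡ suc k
    d∸[k+1]≡k+1 = minus-from-sum {suc k} (trans (sym (2*n≡n+n (suc k)))
                    (≤∧≮⇒≡ (≤-trans (≤-reflexive (*-suc 2 k)) 2k+1<d) 2k+2≮d))

  module _ {g : ℕ → ℕ} (rev : Reverse d h g) where

    Reverse-increasing : ∀ {k} → suc (suc (2 * k)) ≤ d → g k ≤ g (suc k)
    Reverse-increasing {k} 2k+1<d = begin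
      g k           ≡⟨ rev (m+[n∸m]≡n k≤d) ⟩
      h (d ∸ k)     ≤⟨ AltIncreasing-upper 2k+1<d ⟩
      h (d ∸ suc k) ≡⟨ rev (m+[n∸m]≡n k+1≤d) ⟨
      g (suc k)     ∎
      where
      open ≤-Reasoning
      k+1≤d : suc k ≤ d
      k+1≤d = ≤-trans (s≤s (m≤m+n k (k + 0))) (<⇒≤ 2k+1<d)
      k≤d : k ≤ d
      k≤d = <⇒≤ k+1≤d

    AltIncreasing-+reverse : ∀ {i} → 2 * i ≤ d → shift h i + shift g i ≤ h i + g i
    AltIncreasing-+reverse {zero}  _      = z≤n
    AltIncreasing-+reverse {suc k} 2k+2≤d =
      +-mono-≤ (AltIncreasing-lower (<⇒≤ 2k+1<d)) (Reverse-increasing 2k+1<d)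
      where
      2k+1<d : suc (suc (2 * k)) ≤ d
      2k+1<d = ≤-trans (≤-reflexive (sym (*-suc 2 k))) 2k+2≤d

    AltIncreasing-+shiftReverse : ∀ {i} → suc (2 * i) ≤ d → h i + shift g i ≤ h (suc i) + g i
    AltIncreasing-+shiftReverse {zero} 1≤d = begin
      h 0 + 0    ≡⟨ +-identityʳ (h 0) ⟩
      h 0        ≤⟨ AltIncreasing-lower 1≤d ⟩
      h 1        ≤⟨ m≤m+n (h 1) (g 0) ⟩
      h 1 + g 0  ∎
      where open ≤-Reasoning
    AltIncreasing-+shiftReverse {suc k} 2k+3≤d =
      +-mono-≤ (AltIncreasing-lower 2k+3≤d) (Reverse-increasing (<⇒≤ 2k+2<d))
      where
      2k+2<d : suc (suc (suc (2 * k))) ≤ d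
      2k+2<d = ≤-trans (≤-reflexive (cong suc (sym (*-suc 2 k)))) 2k+3≤d

-- Refined Eulerian numbers

-- refinedEulerian n s i is the coefficient of t^i in A_{n+1-s}(n+1, t).  Deleting the last letter s
-- of a permutation of {0, …, n} leaves, after standardisation, a permutation ending in some r, and
-- the deleted position was a descent iff s ≤ r.
refinedEulerian : ℕ → ℕ → ℕ → ℕ
refinedEulerian zero    s zero    = 1
refinedEulerian zero    s (suc i) = 0
refinedEulerian (suc n) s i =
  ∑[ r < suc n ] shiftIf (does (s ≤? toℕ r)) (refinedEulerian n (toℕ r)) i

refinedEulerian-vanishes : ∀ n {s i} → n < i → refinedEulerian n s i ≡ 0
refinedEulerian-vanishes zero    {i = suc i} _   = refl
refinedEulerian-vanishes (suc n) {s} n<i =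
  ∑-zero {suc n} (λ r → shiftIf-vanishes (refinedEulerian-vanishes n {toℕ r}) (does (s ≤? toℕ r)) n<i)

refinedEulerian-symmetric : ∀ n {r r̄ j j̄} → r + r̄ ≡ n → j + j̄ ≡ n →
                            refinedEulerian n r j ≡ refinedEulerian n r̄ j̄
refinedEulerian-symmetric zero    {j = zero} {zero} _ _ = refl
refinedEulerian-symmetric (suc n) {r} {r̄} {j} {j̄} r+r̄ j+j̄ =
  ∑-reflect (suc n) {T r j} {T r̄ j̄}
    (λ q+q̄ → T-symmetric {r} {r̄} {j} {j̄} r+r̄ j+j̄ (suc-injective q+q̄))
  where
  T : ℕ → ℕ → ℕ → ℕ
  T c i q = shiftIf (does (c ≤? q)) (refinedEulerian n q) i

  shift-symmetric : ∀ {q q̄ i ī} → q + q̄ ≡ n → i + ī ≡ suc n →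
            shift (refinedEulerian n q) i ≡ refinedEulerian n q̄ ī
  shift-symmetric {i = zero}  _   refl = sym (refinedEulerian-vanishes n ≤-refl)
  shift-symmetric {i = suc i} q+q̄ i+ī = refinedEulerian-symmetric n q+q̄ (suc-injective i+ī)

  T-symmetric-shifted : ∀ {c c̄ i ī q q̄} → c + c̄ ≡ suc n → i + ī ≡ suc n → q + q̄ ≡ n → c ≤ q →
            T c i q ≡ T c̄ ī q̄
  T-symmetric-shifted {c} {c̄} {i} {ī} {q} {q̄} c+c̄ i+ī q+q̄ c≤q = begin
    T c i q                       ≡⟨ cong (λ b → shiftIf b _ i) (dec-true (c ≤? q) c≤q) ⟩
    shift (refinedEulerian n q) i ≡⟨ shift-symmetric q+q̄ i+ī ⟩
    refinedEulerian n q̄ ī         ≡⟨ cong (λ b → shiftIf b _ ī) (dec-false (c̄ ≤? q̄) (<⇒≱ q̄<c̄)) ⟨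
    T c̄ ī q̄                       ∎
    where
    open ≡-Reasoning
    q̄<c̄ : q̄ < c̄
    q̄<c̄ = complement-≤ (trans c+c̄ (sym (trans (+-suc q q̄) (cong suc q+q̄)))) c≤q

  T-symmetric : ∀ {c c̄ i ī q q̄} → c + c̄ ≡ suc n → i + ī ≡ suc n → q + q̄ ≡ n →
                T c i q ≡ T c̄ ī q̄
  T-symmetric {c} {c̄} {i} {ī} {q} {q̄} c+c̄ i+ī q+q̄ with c ≤? q
  ... | yes c≤q = T-symmetric-shifted c+c̄ i+ī q+q̄ c≤q
  ... | no  c≰q = sym (T-symmetric-shifted (swap-sum c c+c̄) (swap-sum i i+ī) (swap-sum q q+q̄) c̄≤q̄)
    where
    c̄≤q̄ : c̄ ≤ q̄
    c̄≤q̄ = complement-≤ (trans (cong suc q+q̄) (sym c+c̄)) (≰⇒> c≰q)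

module InductionStep {n} (ih : ∀ {r} → 2 * r ≤ n → AltIncreasing n (refinedEulerian n r))
                     {s s̄} (s+s̄ : s + s̄ ≡ suc n) (s≤s̄ : s ≤ s̄) where

  private
    H : ℕ → ℕ → ℕ
    H = refinedEulerian n

    T : ℕ → ℕ → ℕ → ℕ
    T c i r = shiftIf (does (c ≤? r)) (H r) i

    T-below : ∀ {c i r} → r < c → T c i r ≡ H r i
    T-below {c} {i} {r} r<c = cong (λ b → shiftIf b (H r) i) (dec-false (c ≤? r) (<⇒≱ r<c))

    T-above : ∀ {c i r} → c ≤ r → T c i r ≡ shift (H r) i
    T-above {c} {i} {r} c≤r = cong (λ b → shiftIf b (H r) i) (dec-true (c ≤? r) c≤r)

    H-reverse : ∀ {r r̄} → r + r̄ ≡ n → Reverse n (H r) (H r̄)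
    H-reverse {r} r+r̄ = refinedEulerian-symmetric n (swap-sum r r+r̄)

    middle-pair : ∀ {r r̄ i} → r + r̄ ≡ n → 2 * i ≤ n →
                  shift (H r) i + shift (H r̄) i ≤ H r i + H r̄ i
    middle-pair {r} {r̄} {i} r+r̄ 2i≤n with ≤-total r r̄
    ... | inj₁ r≤r̄ = AltIncreasing-+reverse (ih (double≤sum r≤r̄ r+r̄)) (H-reverse r+r̄) 2i≤n
    ... | inj₂ r̄≤r = subst₂ _≤_ (+-comm (shift (H r̄) i) _) (+-comm (H r̄ i) _)
          (AltIncreasing-+reverse (ih (double≤sum r̄≤r r̄+r)) (H-reverse r̄+r) 2i≤n)
      where
      r̄+r : r̄ + r ≡ n
      r̄+r = swap-sum r r+r̄

    outer-complement : ∀ {r r̄} → r + r̄ ≡ n → r < s → s̄ ≤ r̄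
    outer-complement r+r̄ r<s = complement-≤ (trans (cong suc r+r̄) (sym s+s̄)) r<s

    middle-complement : ∀ {r r̄} → r + r̄ ≡ n → s ≤ r̄ → r < s̄
    middle-complement {r} {r̄} r+r̄ s≤r̄ =
      complement-≤ (trans s+s̄ (sym (trans (+-suc r̄ r) (cong suc (swap-sum r r+r̄))))) s≤r̄

    ∑-mono-by-region : (f g : ℕ → ℕ) →
      (∀ {r r̄} → r + r̄ ≡ n → r < s → f r + f r̄ ≤ g r + g r̄) →
      (∀ {r r̄} → r + r̄ ≡ n → s ≤ r → s ≤ r̄ → f r + f r̄ ≤ g r + g r̄) →
      ∑[ r < suc n ] f (toℕ r) ≤ ∑[ r < suc n ] g (toℕ r)
    ∑-mono-by-region f g outer middle = ∑-mono-paired (suc n) {f} {g} (λ eq → pair (suc-injective eq))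
      where
      pair : ∀ {r r̄} → r + r̄ ≡ n → f r + f r̄ ≤ g r + g r̄
      pair {r} {r̄} r+r̄ with r <? s | r̄ <? s
      ... | yes r<s | _        = outer r+r̄ r<s
      ... | no  _   | yes r̄<s  = subst₂ _≤_ (+-comm (f r̄) (f r)) (+-comm (g r̄) (g r))
                                   (outer (swap-sum r r+r̄) r̄<s)
      ... | no  r≮s | no  r̄≮s = middle r+r̄ (≮⇒≥ r≮s) (≮⇒≥ r̄≮s)

  step-below : ∀ {i} → 2 * i ≤ n → refinedEulerian (suc n) s i ≤ refinedEulerian (suc n) s̄ i
  step-below {i} 2i≤n =
    ∑-mono-by-region (T s i) (T s̄ i) outer middle
    where

    outer : ∀ {r r̄} → r + r̄ ≡ n → r < s → T s i r + T s i r̄ ≤ T s̄ i r + T s̄ i r̄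
    outer {r} {r̄} r+r̄ r<s = ≤-reflexive (begin
      T s i r + T s i r̄      ≡⟨ cong₂ _+_ (T-below r<s) (T-above (≤-trans s≤s̄ s̄≤r̄)) ⟩
      H r i + shift (H r̄) i  ≡⟨ cong₂ _+_ (T-below (<-≤-trans r<s s≤s̄)) (T-above s̄≤r̄) ⟨
      T s̄ i r + T s̄ i r̄      ∎)
      where
      open ≡-Reasoning
      s̄≤r̄ : s̄ ≤ r̄
      s̄≤r̄ = outer-complement r+r̄ r<s

    middle : ∀ {r r̄} → r + r̄ ≡ n → s ≤ r → s ≤ r̄ → T s i r + T s i r̄ ≤ T s̄ i r + T s̄ i r̄
    middle {r} {r̄} r+r̄ s≤r s≤r̄ = begin
      T s i r + T s i r̄              ≡⟨ cong₂ _+_ (T-above s≤r) (T-above s≤r̄) ⟩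
      shift (H r) i + shift (H r̄) i  ≤⟨ middle-pair r+r̄ 2i≤n ⟩
      H r i + H r̄ i                  ≡⟨ cong₂ _+_ (T-below (middle-complement r+r̄ s≤r̄))
                                                  (T-below (middle-complement (swap-sum r r+r̄) s≤r)) ⟨
      T s̄ i r + T s̄ i r̄              ∎
      where open ≤-Reasoning

  step-above : ∀ {i} → suc (2 * i) ≤ n →
               refinedEulerian (suc n) s̄ i ≤ refinedEulerian (suc n) s (suc i)
  step-above {i} 2i<n =
    ∑-mono-by-region (T s̄ i) (T s (suc i)) outer middle
    where

    outer : ∀ {r r̄} → r + r̄ ≡ n → r < s →
            T s̄ i r + T s̄ i r̄ ≤ T s (suc i) r + T s (suc i) r̄
    outer {r} {r̄} r+r̄ r<s = begin
      T s̄ i r + T s̄ i r̄             ≡⟨ cong₂ _+_ (T-below (<-≤-trans r<s s≤s̄)) (T-above s̄≤r̄) ⟩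
      H r i + shift (H r̄) i         ≤⟨ AltIncreasing-+shiftReverse (ih 2r≤n) (H-reverse r+r̄) 2i<n ⟩
      H r (suc i) + H r̄ i           ≡⟨ cong₂ _+_ (T-below r<s) (T-above (≤-trans s≤s̄ s̄≤r̄)) ⟨
      T s (suc i) r + T s (suc i) r̄ ∎
      where
      open ≤-Reasoning
      s̄≤r̄ : s̄ ≤ r̄
      s̄≤r̄ = outer-complement r+r̄ r<s
      2r≤n : 2 * r ≤ n
      2r≤n = double≤sum (<⇒≤ (<-≤-trans r<s (≤-trans s≤s̄ s̄≤r̄))) r+r̄

    middle : ∀ {r r̄} → r + r̄ ≡ n → s ≤ r → s ≤ r̄ →
             T s̄ i r + T s̄ i r̄ ≤ T s (suc i) r + T s (suc i) r̄
    middle {r} {r̄} r+r̄ s≤r s≤r̄ = ≤-reflexive (begin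
      T s̄ i r + T s̄ i r̄              ≡⟨ cong₂ _+_ (T-below (middle-complement r+r̄ s≤r̄))
                                                  (T-below (middle-complement (swap-sum r r+r̄) s≤r)) ⟩
      H r i + H r̄ i                  ≡⟨ cong₂ _+_ (T-above s≤r) (T-above s≤r̄) ⟨
      T s (suc i) r + T s (suc i) r̄  ∎)
      where open ≡-Reasoning

refinedEulerian-AltIncreasing : ∀ n {s} → 2 * s ≤ n → AltIncreasing n (refinedEulerian n s)
refinedEulerian-AltIncreasing zero    _    _ = (λ ()) , (λ ())
refinedEulerian-AltIncreasing (suc n) {s} 2s≤n+1 i = below , above
  where
  open ≤-Reasoning
  E : ℕ → ℕ → ℕ
  E = refinedEulerian (suc n)
  s̄ : ℕ
  s̄ = suc n ∸ s

  s+s̄ : s + s̄ ≡ suc n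
  s+s̄ = m+[n∸m]≡n (≤-trans (m≤m+n s (s + 0)) 2s≤n+1)

  s≤s̄ : s ≤ s̄
  s≤s̄ = +-cancelˡ-≤ s s s̄ (begin
    s + s    ≡⟨ 2*n≡n+n s ⟨
    2 * s    ≤⟨ 2s≤n+1 ⟩
    suc n    ≡⟨ s+s̄ ⟨
    s + s̄    ∎)

  open InductionStep (refinedEulerian-AltIncreasing n) s+s̄ s≤s̄

  mirror : i ≤ suc n → E s (suc n ∸ i) ≡ E s̄ i
  mirror i≤n+1 = refinedEulerian-symmetric (suc n) {s} {s̄} {suc n ∸ i} {i} s+s̄ (m∸n+n≡m i≤n+1)

  below : suc (2 * i) ≤ suc n → E s i ≤ E s (suc n ∸ i)
  below 2i<n+1 = begin
    E s i             ≤⟨ step-below (s≤s⁻¹ 2i<n+1) ⟩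
    E s̄ i             ≡⟨ mirror (≤-trans (m≤m+n i (i + 0)) (<⇒≤ 2i<n+1)) ⟨
    E s (suc n ∸ i)   ∎

  above : suc (suc (2 * i)) ≤ suc n → E s (suc n ∸ i) ≤ E s (suc i)
  above 2i+1<n+1 = begin
    E s (suc n ∸ i)   ≡⟨ mirror (≤-trans (m≤m+n i (i + 0)) (<⇒≤ (<⇒≤ 2i+1<n+1))) ⟩
    E s̄ i             ≤⟨ step-above (s≤s⁻¹ 2i+1<n+1) ⟩
    E s (suc i)       ∎

-- Counting words

∑ᵛ : ∀ {M} k → (Vec (Fin M) k → ℕ) → ℕ
∑ᵛ         zero    f = f []
∑ᵛ {M} (suc k) f = ∑[ x < M ] ∑ᵛ k (f ∘ (x ∷_))

∑ᵛ-cong : ∀ {M} k {f g : Vec (Fin M) k → ℕ} → (∀ w → f w ≡ g w) → ∑ᵛ k f ≡ ∑ᵛ k g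
∑ᵛ-cong zero    f≡g = f≡g []
∑ᵛ-cong (suc k) f≡g = sum-cong-≗ (λ x → ∑ᵛ-cong k (f≡g ∘ (x ∷_)))

∑ᵛ-zero : ∀ {M} k → ∑ᵛ {M} k (λ _ → 0) ≡ 0
∑ᵛ-zero zero    = refl
∑ᵛ-zero {M} (suc k) = ∑-zero {M} (λ _ → ∑ᵛ-zero k)

∑ᵛ-∷ʳ : ∀ {M} k (f : Vec (Fin M) (suc k) → ℕ) →
        ∑ᵛ (suc k) f ≡ ∑ᵛ k (λ w → ∑[ x < M ] f (w ∷ʳ x))
∑ᵛ-∷ʳ zero    f = refl
∑ᵛ-∷ʳ (suc k) f = sum-cong-≗ (λ y → ∑ᵛ-∷ʳ k (f ∘ (y ∷_)))

∑ᵛ-comm : ∀ {M N} k (f : Vec (Fin M) k → Fin N → ℕ) →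
          ∑ᵛ k (λ w → ∑[ l < N ] f w l) ≡ ∑[ l < N ] ∑ᵛ k (λ w → f w l)
∑ᵛ-comm zero    f = refl
∑ᵛ-comm (suc k) f =
  trans (sum-cong-≗ (λ x → ∑ᵛ-comm k (f ∘ (x ∷_)))) (∑-comm (λ x l → ∑ᵛ k (λ w → f (x ∷ w) l)))

∑ᵛ-*ˡ : ∀ {M} c k (f : Vec (Fin M) k → ℕ) → c * ∑ᵛ k f ≡ ∑ᵛ k (λ w → c * f w)
∑ᵛ-*ˡ c zero    f = refl
∑ᵛ-*ˡ c (suc k) f =
  trans (*-distribˡ-sum c (λ x → ∑ᵛ k (f ∘ (x ∷_)))) (sum-cong-≗ (λ x → ∑ᵛ-*ˡ c k (f ∘ (x ∷_))))

∑ᵛ-shiftIf : ∀ {M} k (c st : Vec (Fin M) k → ℕ) b i →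
             ∑ᵛ k (λ w → c w * 𝟙 (does (st w + 𝟙 b ≟ i)))
             ≡ shiftIf b (λ j → ∑ᵛ k (λ w → c w * 𝟙 (does (st w ≟ j)))) i
∑ᵛ-shiftIf k c st b i = trans (∑ᵛ-cong k (λ w → cong (c w *_) (indicator-shift (st w) b i))) (pull b i)
  where
  indicator-shift : ∀ m b i → 𝟙 (does (m + 𝟙 b ≟ i)) ≡ shiftIf b (λ j → 𝟙 (does (m ≟ j))) i
  indicator-shift m false i       = cong (λ x → 𝟙 (does (x ≟ i))) (+-identityʳ m)
  indicator-shift m true  zero    = cong (λ x → 𝟙 (does (x ≟ 0))) (+-comm m 1)
  indicator-shift m true  (suc i) = cong (λ x → 𝟙 (does (x ≟ suc i))) (+-comm m 1)

  pull : ∀ b i → ∑ᵛ k (λ w → c w * shiftIf b (λ j → 𝟙 (does (st w ≟ j))) i)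
                 ≡ shiftIf b (λ j → ∑ᵛ k (λ w → c w * 𝟙 (does (st w ≟ j)))) i
  pull false i       = refl
  pull true  zero    = trans (∑ᵛ-cong k (λ w → *-zeroʳ (c w))) (∑ᵛ-zero k)
  pull true  (suc i) = refl

length-filter : ∀ {A : Set} {P : A → Set} (P? : Decidable P) xs →
                length (filter P? xs) ≡ sumˡ (map (λ x → 𝟙 (does (P? x))) xs)
length-filter P? []       = refl
length-filter P? (x ∷ xs) with does (P? x)
... | true  = cong suc (length-filter P? xs)
... | false = length-filter P? xs

sumˡ-map-filter : ∀ {A : Set} {P : A → Set} (P? : Decidable P) (f : A → ℕ) xs →
                  sumˡ (map f (filter P? xs)) ≡ sumˡ (map (λ x → 𝟙 (does (P? x)) * f x) xs)
sumˡ-map-filter P? f []       = refl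
sumˡ-map-filter P? f (x ∷ xs) with does (P? x)
... | true  = cong₂ _+_ (sym (+-identityʳ (f x))) (sumˡ-map-filter P? f xs)
... | false = sumˡ-map-filter P? f xs

sumˡ-map-concatMap : ∀ {A B : Set} {n} (f : B → ℕ) (g : A → List B) (h : Fin n → A) →
                     sumˡ (map f (concatMap g (tabulate h))) ≡ ∑[ x < n ] sumˡ (map f (g (h x)))
sumˡ-map-concatMap {n = zero}  f g h = refl
sumˡ-map-concatMap {n = suc n} f g h =
  trans (cong sumˡ (map-++ f (g (h zero)) _))
        (trans (sum-++ (map f (g (h zero))) _) (cong (_ +_) (sumˡ-map-concatMap f g (h ∘ suc))))

sumˡ-map-words : ∀ {M} k (f : Vec (Fin M) k → ℕ) → sumˡ (map f (words k M)) ≡ ∑ᵛ k f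
sumˡ-map-words         zero    f = +-identityʳ (f [])
sumˡ-map-words {M} (suc k) f =
  trans (sumˡ-map-concatMap f (λ x → map (x ∷_) (words k M)) (λ x → x))
        (sum-cong-≗ {M} (λ x → trans (cong sumˡ (sym (map-∘ (words k M))))
                                     (sumˡ-map-words k (f ∘ (x ∷_)))))

_∈ᵇ_ : ∀ {M} → Fin M → Subset M → Bool
x ∈ᵇ A = lookup A x

≟-sym : ∀ {M} (x y : Fin M) → does (x Fin.≟ y) ≡ does (y Fin.≟ x)
≟-sym x y = does-⇔ (mk⇔ sym sym) (x Fin.≟ y) (y Fin.≟ x)

∈ᵇ-remove : ∀ {M} (A : Subset M) x y → y ∈ᵇ (A - x) ≡ y ∈ᵇ A ∧ not (does (x Fin.≟ y))
∈ᵇ-remove (b ∷ A) zero    zero    = sym (∧-zeroʳ b)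
∈ᵇ-remove (b ∷ A) zero    (suc y) = trans (cong (_∈ᵇ_ y) (p─⊥≡p A)) (sym (∧-identityʳ (y ∈ᵇ A)))
∈ᵇ-remove (b ∷ A) (suc x) zero    = sym (∧-identityʳ b)
∈ᵇ-remove (b ∷ A) (suc x) (suc y) = ∈ᵇ-remove A x y

distinctIn : ∀ {M k} → Subset M → Vec (Fin M) k → Bool
distinctIn A []      = true
distinctIn A (x ∷ w) = x ∈ᵇ A ∧ distinctIn (A - x) w

distinctIn-∷ʳ : ∀ {M k} (A : Subset M) (w : Vec (Fin M) k) x →
                distinctIn A (w ∷ʳ x) ≡ x ∈ᵇ A ∧ distinctIn (A - x) w
distinctIn-∷ʳ A []      x = refl
distinctIn-∷ʳ A (y ∷ w) x = begin
  y ∈ᵇ A ∧ distinctIn (A - y) (w ∷ʳ x)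
    ≡⟨ cong (y ∈ᵇ A ∧_) (distinctIn-∷ʳ (A - y) w x) ⟩
  y ∈ᵇ A ∧ (x ∈ᵇ (A - y) ∧ distinctIn (A - y - x) w)
    ≡⟨ cong₂ (λ a B → y ∈ᵇ A ∧ (a ∧ distinctIn B w)) (∈ᵇ-remove A y x) (p─x─y≡p─y─x A y x) ⟩
  y ∈ᵇ A ∧ ((x ∈ᵇ A ∧ not (does (y Fin.≟ x))) ∧ D)
    ≡⟨ cong (y ∈ᵇ A ∧_) (∧-assoc (x ∈ᵇ A) _ D) ⟩
  y ∈ᵇ A ∧ (x ∈ᵇ A ∧ (not (does (y Fin.≟ x)) ∧ D))
    ≡⟨ x∙yz≈y∙xz (y ∈ᵇ A) (x ∈ᵇ A) _ ⟩
  x ∈ᵇ A ∧ (y ∈ᵇ A ∧ (not (does (y Fin.≟ x)) ∧ D))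
    ≡⟨ cong (x ∈ᵇ A ∧_) (∧-assoc (y ∈ᵇ A) _ D) ⟨
  x ∈ᵇ A ∧ ((y ∈ᵇ A ∧ not (does (y Fin.≟ x))) ∧ D)
    ≡⟨ cong (λ e → x ∈ᵇ A ∧ ((y ∈ᵇ A ∧ not e) ∧ D)) (≟-sym y x) ⟩
  x ∈ᵇ A ∧ ((y ∈ᵇ A ∧ not (does (x Fin.≟ y))) ∧ D)
    ≡⟨ cong (λ a → x ∈ᵇ A ∧ (a ∧ D)) (∈ᵇ-remove A x y) ⟨
  x ∈ᵇ A ∧ (y ∈ᵇ (A - x) ∧ D)
    ∎
  where
  open ≡-Reasoning
  D : Bool
  D = distinctIn (A - x - y) w

all-∈ᵇ-remove : ∀ {M} (A : Subset M) x ys →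
                all (_∈ᵇ (A - x)) ys ≡ all (_∈ᵇ A) ys ∧ does (all? (λ y → ¬? (x Fin.≟ y)) ys)
all-∈ᵇ-remove A x []       = refl
all-∈ᵇ-remove A x (y ∷ ys) =
  trans (cong₂ _∧_ (∈ᵇ-remove A x y) (all-∈ᵇ-remove A x ys))
        (interchange (y ∈ᵇ A) (not (does (x Fin.≟ y))) (all (_∈ᵇ A) ys) _)

distinctIn-all : ∀ {M k} (A : Subset M) (w : Vec (Fin M) k) →
                 distinctIn A w ≡ all (_∈ᵇ A) (toList w) ∧ does (UniqueDec.unique? Fin._≟_ (toList w))
distinctIn-all A []      = refl
distinctIn-all A (x ∷ w) = begin
  x ∈ᵇ A ∧ distinctIn (A - x) w                      ≡⟨ cong (x ∈ᵇ A ∧_) (distinctIn-all (A - x) w) ⟩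
  x ∈ᵇ A ∧ (all (_∈ᵇ (A - x)) (toList w) ∧ U)       ≡⟨ cong (λ a → x ∈ᵇ A ∧ (a ∧ U))
                                                              (all-∈ᵇ-remove A x (toList w)) ⟩
  x ∈ᵇ A ∧ ((all (_∈ᵇ A) (toList w) ∧ N) ∧ U)       ≡⟨ cong (x ∈ᵇ A ∧_) (∧-assoc _ N U) ⟩
  x ∈ᵇ A ∧ (all (_∈ᵇ A) (toList w) ∧ (N ∧ U))       ≡⟨ ∧-assoc (x ∈ᵇ A) _ _ ⟨
  (x ∈ᵇ A ∧ all (_∈ᵇ A) (toList w)) ∧ (N ∧ U)       ∎
  where
  open ≡-Reasoning
  U N : Bool
  U = does (UniqueDec.unique? Fin._≟_ (toList w))
  N = does (all? (λ y → ¬? (x Fin.≟ y)) (toList w))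

distinctIn-⊤ : ∀ {M k} (w : Vec (Fin M) k) → distinctIn ⊤ w ≡ does (UniqueDec.unique? Fin._≟_ (toList w))
distinctIn-⊤ w =
  trans (distinctIn-all ⊤ w) (cong (_∧ does (UniqueDec.unique? Fin._≟_ (toList w))) (all-∈ᵇ-⊤ (toList w)))
  where
  all-∈ᵇ-⊤ : ∀ xs → all (_∈ᵇ ⊤) xs ≡ true
  all-∈ᵇ-⊤ []       = refl
  all-∈ᵇ-⊤ (x ∷ xs) = cong₂ _∧_ (lookup-replicate x true) (all-∈ᵇ-⊤ xs)

rank : ∀ {M} → Subset M → Fin M → ℕ
rank (b ∷ A) zero    = 0
rank (b ∷ A) (suc x) = 𝟙 b + rank A x

rank-⊤ : ∀ {M} (x : Fin M) → rank ⊤ x ≡ toℕ x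
rank-⊤ zero    = refl
rank-⊤ (suc x) = cong suc (rank-⊤ x)

∣A∣≡suc∣A-x∣ : ∀ {M} (A : Subset M) {x} → x ∈ᵇ A ≡ true → ∣ A ∣ ≡ suc ∣ A - x ∣
∣A∣≡suc∣A-x∣ (true  ∷ A) {zero}  _   = cong suc (sym (cong ∣_∣ (p─⊥≡p A)))
∣A∣≡suc∣A-x∣ (true  ∷ A) {suc x} x∈A = cong suc (∣A∣≡suc∣A-x∣ A x∈A)
∣A∣≡suc∣A-x∣ (false ∷ A) {suc x} x∈A = ∣A∣≡suc∣A-x∣ A x∈A

∑-rank : ∀ {M} (B : Subset M) (h : ℕ → ℕ) →
         ∑[ l < M ] (𝟙 (l ∈ᵇ B) * h (rank B l)) ≡ ∑[ r < ∣ B ∣ ] h (toℕ r)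
∑-rank []          h = refl
∑-rank (true  ∷ B) h = cong₂ _+_ (+-identityʳ (h 0)) (∑-rank B (h ∘ suc))
∑-rank (false ∷ B) h = ∑-rank B h

-- Standardisation: for l ∈ A - x, x < l iff rank A x ≤ rank (A - x) l.
∑-rank-remove : ∀ {M} (A : Subset M) {x} → x ∈ᵇ A ≡ true → (g : ℕ → Bool → ℕ) →
                ∑[ l < M ] (𝟙 (l ∈ᵇ (A - x)) * g (rank (A - x) l) (does (x Fin.<? l)))
                ≡ ∑[ r < ∣ A - x ∣ ] g (toℕ r) (does (rank A x ≤? toℕ r))
∑-rank-remove (true  ∷ A) {zero}  _   g = ∑-rank (A ─ ⊥) (λ r → g r true)
∑-rank-remove (false ∷ A) {suc x} x∈A g = ∑-rank-remove A x∈A g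
∑-rank-remove (true  ∷ A) {suc x} x∈A g =
  cong₂ _+_ (+-identityʳ (g 0 false))
    (trans (∑-rank-remove A x∈A (g ∘ suc))
           (sum-cong-≗ {∣ A - x ∣} (λ r → cong (g (suc (toℕ r)))
             (does-⇔ (mk⇔ s≤s s≤s⁻¹) (rank A x ≤? toℕ r) (suc (rank A x) ≤? suc (toℕ r))))))

des-∷ʳ : ∀ {M k} (w : Vec (Fin M) (suc k)) x → des (w ∷ʳ x) ≡ des w + 𝟙 (does (x Fin.<? last w))
des-∷ʳ (y ∷ [])    x = +-identityʳ _
des-∷ʳ (y ∷ z ∷ w) x = trans (cong (𝟙 (does (z Fin.<? y)) +_) (des-∷ʳ (z ∷ w) x))
                             (sym (+-assoc (𝟙 (does (z Fin.<? y))) (des (z ∷ w)) _))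

refinedEulerian-counts : ∀ {M} k (A : Subset M) c i → ∣ A ∣ ≡ suc k →
  ∑ᵛ (suc k) (λ w → 𝟙 (does (last w Fin.≟ c)) * 𝟙 (distinctIn A w) * 𝟙 (does (des w ≟ i)))
  ≡ 𝟙 (c ∈ᵇ A) * refinedEulerian k (rank A c) i
refinedEulerian-counts {M} zero A c i _ = begin
  ∑[ x < M ] (𝟙 (does (x Fin.≟ c)) * 𝟙 (x ∈ᵇ A ∧ true) * 𝟙 (does (0 ≟ i)))
    ≡⟨ sum-cong-≗ {M} (λ x → *-assoc (𝟙 (does (x Fin.≟ c))) _ _) ⟩
  ∑[ x < M ] (𝟙 (does (x Fin.≟ c)) * (𝟙 (x ∈ᵇ A ∧ true) * 𝟙 (does (0 ≟ i))))
    ≡⟨ ∑-delta c (λ x → 𝟙 (x ∈ᵇ A ∧ true) * 𝟙 (does (0 ≟ i))) ⟩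
  𝟙 (c ∈ᵇ A ∧ true) * 𝟙 (does (0 ≟ i))
    ≡⟨ cong₂ (λ b e → 𝟙 b * e) (∧-identityʳ (c ∈ᵇ A)) (single i) ⟩
  𝟙 (c ∈ᵇ A) * refinedEulerian 0 (rank A c) i
    ∎
  where
  open ≡-Reasoning
  single : ∀ i → 𝟙 (does (0 ≟ i)) ≡ refinedEulerian 0 (rank A c) i
  single zero    = refl
  single (suc i) = refl
refinedEulerian-counts {M} (suc k) A c i ∣A∣≡k+2 = begin
  ∑ᵛ (suc (suc k)) F
    ≡⟨ ∑ᵛ-∷ʳ (suc k) F ⟩
  ∑ᵛ (suc k) (λ w → ∑[ x < M ] F (w ∷ʳ x))
    ≡⟨ ∑ᵛ-cong (suc k) remove-last ⟩
  ∑ᵛ (suc k) (λ w → 𝟙 (c ∈ᵇ A) * G w)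
    ≡⟨ ∑ᵛ-*ˡ (𝟙 (c ∈ᵇ A)) (suc k) G ⟨
  𝟙 (c ∈ᵇ A) * ∑ᵛ (suc k) G
    ≡⟨ when-member (c ∈ᵇ A) refl ⟩
  𝟙 (c ∈ᵇ A) * refinedEulerian (suc k) (rank A c) i
    ∎
  where
  open ≡-Reasoning
  B : Subset M
  B = A - c
  F : Vec (Fin M) (suc (suc k)) → ℕ
  F w = 𝟙 (does (last w Fin.≟ c)) * 𝟙 (distinctIn A w) * 𝟙 (does (des w ≟ i))
  G : Vec (Fin M) (suc k) → ℕ
  G w = 𝟙 (distinctIn B w) * 𝟙 (does (des w + 𝟙 (does (c Fin.<? last w)) ≟ i))

  remove-last : ∀ w → ∑[ x < M ] F (w ∷ʳ x) ≡ 𝟙 (c ∈ᵇ A) * G w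
  remove-last w = begin
    ∑[ x < M ] F (w ∷ʳ x)                        ≡⟨ sum-cong-≗ {M} split ⟩
    ∑[ x < M ] (𝟙 (does (x Fin.≟ c)) * g x)      ≡⟨ ∑-delta c g ⟩
    𝟙 (c ∈ᵇ A) * G w                             ∎
    where
    g : Fin M → ℕ
    g x = 𝟙 (x ∈ᵇ A) * (𝟙 (distinctIn (A - x) w) * 𝟙 (does (des w + 𝟙 (does (x Fin.<? last w)) ≟ i)))

    split : ∀ x → F (w ∷ʳ x) ≡ 𝟙 (does (x Fin.≟ c)) * g x
    split x = begin
      F (w ∷ʳ x)
        ≡⟨ cong₂ _*_ (cong₂ _*_ (cong (λ y → 𝟙 (does (y Fin.≟ c))) (last-∷ʳ x w))
                                (trans (cong 𝟙 (distinctIn-∷ʳ A w x)) (𝟙-∧ (x ∈ᵇ A) _)))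
                     (cong (λ d → 𝟙 (does (d ≟ i))) (des-∷ʳ w x)) ⟩
      𝟙 (does (x Fin.≟ c)) * (𝟙 (x ∈ᵇ A) * D) * E
        ≡⟨ *-assoc (𝟙 (does (x Fin.≟ c))) _ E ⟩
      𝟙 (does (x Fin.≟ c)) * (𝟙 (x ∈ᵇ A) * D * E)
        ≡⟨ cong (𝟙 (does (x Fin.≟ c)) *_) (*-assoc (𝟙 (x ∈ᵇ A)) D E) ⟩
      𝟙 (does (x Fin.≟ c)) * g x
        ∎
      where
      D E : ℕ
      D = 𝟙 (distinctIn (A - x) w)
      E = 𝟙 (does (des w + 𝟙 (does (x Fin.<? last w)) ≟ i))

  when-member : ∀ b → c ∈ᵇ A ≡ b → 𝟙 b * ∑ᵛ (suc k) G ≡ 𝟙 b * refinedEulerian (suc k) (rank A c) i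
  when-member false _   = refl
  when-member true  c∈A = cong (1 *_) (begin
    ∑ᵛ (suc k) G
      ≡⟨ ∑ᵛ-cong (suc k) (λ w → sym (group-by-last w)) ⟩
    ∑ᵛ (suc k) (λ w → ∑[ l < M ] H w l)
      ≡⟨ ∑ᵛ-comm (suc k) H ⟩
    ∑[ l < M ] ∑ᵛ (suc k) (λ w → H w l)
      ≡⟨ sum-cong-≗ {M} (λ l → ∑ᵛ-shiftIf (suc k) (ends-in l) des (does (c Fin.<? l)) i) ⟩
    ∑[ l < M ] shiftIf (does (c Fin.<? l)) (λ j → ∑ᵛ (suc k) (λ w → ends-in l w * 𝟙 (does (des w ≟ j)))) i
      ≡⟨ sum-cong-≗ {M} (λ l → shiftIf-cong (does (c Fin.<? l)) i
                                  (λ j → refinedEulerian-counts k B l j ∣B∣≡k+1)) ⟩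
    ∑[ l < M ] shiftIf (does (c Fin.<? l)) (λ j → 𝟙 (l ∈ᵇ B) * refinedEulerian k (rank B l) j) i
      ≡⟨ sum-cong-≗ {M} (λ l → shiftIf-*ˡ (𝟙 (l ∈ᵇ B)) (does (c Fin.<? l))
                                             (refinedEulerian k (rank B l)) i) ⟩
    ∑[ l < M ] (𝟙 (l ∈ᵇ B) * shiftIf (does (c Fin.<? l)) (refinedEulerian k (rank B l)) i)
      ≡⟨ ∑-rank-remove A c∈A (λ r b → shiftIf b (refinedEulerian k r) i) ⟩
    ∑[ r < ∣ B ∣ ] shiftIf (does (rank A c ≤? toℕ r)) (refinedEulerian k (toℕ r)) i
      ≡⟨ cong (λ m → ∑[ r < m ] shiftIf (does (rank A c ≤? toℕ r)) (refinedEulerian k (toℕ r)) i)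
              ∣B∣≡k+1 ⟩
    refinedEulerian (suc k) (rank A c) i
      ∎)
    where
    ends-in : Fin M → Vec (Fin M) (suc k) → ℕ
    ends-in l w = 𝟙 (does (last w Fin.≟ l)) * 𝟙 (distinctIn B w)

    H : Vec (Fin M) (suc k) → Fin M → ℕ
    H w l = ends-in l w * 𝟙 (does (des w + 𝟙 (does (c Fin.<? l)) ≟ i))

    group-by-last : ∀ w → ∑[ l < M ] H w l ≡ G w
    group-by-last w =
      trans (sum-cong-≗ {M} (λ l → trans (*-assoc (𝟙 (does (last w Fin.≟ l))) _ _)
                                         (cong (λ b → 𝟙 b * g l) (≟-sym (last w) l))))
            (∑-delta (last w) g)
      where
      g : Fin M → ℕ
      g l = 𝟙 (distinctIn B w) * 𝟙 (does (des w + 𝟙 (does (c Fin.<? l)) ≟ i))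

    ∣B∣≡k+1 : ∣ B ∣ ≡ suc k
    ∣B∣≡k+1 = suc-injective (trans (sym (∣A∣≡suc∣A-x∣ A c∈A)) ∣A∣≡k+2)

Acoeff≡refinedEulerian : ∀ d j i → Acoeff d (suc j) i ≡ refinedEulerian d (d ∸ j) i
Acoeff≡refinedEulerian d j i = begin
  Acoeff d (suc j) i
    ≡⟨ length-filter _ (perms (suc d)) ⟩
  sumˡ (map (λ σ → 𝟙 (does (P? σ))) (perms (suc d)))
    ≡⟨ sumˡ-map-filter _ (λ σ → 𝟙 (does (P? σ))) (words (suc d) (suc d)) ⟩
  sumˡ (map (λ σ → 𝟙 (does (U? σ)) * 𝟙 (does (P? σ))) (words (suc d) (suc d)))
    ≡⟨ sumˡ-map-words (suc d) _ ⟩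
  ∑ᵛ (suc d) (λ σ → 𝟙 (does (U? σ)) * 𝟙 (does (P? σ)))
    ≡⟨ ∑ᵛ-cong (suc d) rearrange ⟩
  ∑ᵛ (suc d) (λ σ → 𝟙 (does (last σ Fin.≟ c)) * 𝟙 (distinctIn ⊤ σ) * 𝟙 (does (des σ ≟ i)))
    ≡⟨ refinedEulerian-counts d ⊤ c i (∣⊤∣≡n (suc d)) ⟩
  𝟙 (c ∈ᵇ ⊤) * refinedEulerian d (rank ⊤ c) i
    ≡⟨ cong₂ (λ b r → 𝟙 b * refinedEulerian d r i) (lookup-replicate c true) (trans (rank-⊤ c) toℕc) ⟩
  1 * refinedEulerian d (d ∸ j) i
    ≡⟨ *-identityˡ _ ⟩
  refinedEulerian d (d ∸ j) i
    ∎
  where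
  open ≡-Reasoning
  c : Fin (suc d)
  c = fromℕ< (s≤s (m∸n≤m d j))
  toℕc : toℕ c ≡ d ∸ j
  toℕc = toℕ-fromℕ< (s≤s (m∸n≤m d j))

  U? : Decidable (λ (σ : Vec (Fin (suc d)) (suc d)) → Unique (toList σ))
  U? σ = UniqueDec.unique? Fin._≟_ (toList σ)
  P? : Decidable (λ (σ : Vec (Fin (suc d)) (suc d)) → toℕ (last σ) ≡ d ∸ j × des σ ≡ i)
  P? σ = (toℕ (last σ) ≟ (d ∸ j)) ×-dec (des σ ≟ i)

  rearrange : ∀ σ → 𝟙 (does (U? σ)) * 𝟙 (does (P? σ))
                    ≡ 𝟙 (does (last σ Fin.≟ c)) * 𝟙 (distinctIn ⊤ σ) * 𝟙 (does (des σ ≟ i))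
  rearrange σ = begin
    𝟙 (does (U? σ)) * 𝟙 (does (P? σ))
      ≡⟨ cong₂ _*_ (cong 𝟙 (sym (distinctIn-⊤ σ))) (𝟙-∧ (does (toℕ (last σ) ≟ (d ∸ j))) _) ⟩
    𝟙 (distinctIn ⊤ σ) * (𝟙 (does (toℕ (last σ) ≟ (d ∸ j))) * 𝟙 (does (des σ ≟ i)))
      ≡⟨ cong (λ b → 𝟙 (distinctIn ⊤ σ) * (𝟙 b * 𝟙 (does (des σ ≟ i))))
              (does-⇔ last≡c (toℕ (last σ) ≟ (d ∸ j)) (last σ Fin.≟ c)) ⟩
    𝟙 (distinctIn ⊤ σ) * (𝟙 (does (last σ Fin.≟ c)) * 𝟙 (does (des σ ≟ i)))
      ≡⟨ *-assoc (𝟙 (distinctIn ⊤ σ)) _ _ ⟨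
    𝟙 (distinctIn ⊤ σ) * 𝟙 (does (last σ Fin.≟ c)) * 𝟙 (does (des σ ≟ i))
      ≡⟨ cong (_* 𝟙 (does (des σ ≟ i))) (*-comm (𝟙 (distinctIn ⊤ σ)) _) ⟩
    𝟙 (does (last σ Fin.≟ c)) * 𝟙 (distinctIn ⊤ σ) * 𝟙 (does (des σ ≟ i))
      ∎
    where
    last≡c : toℕ (last σ) ≡ d ∸ j ⇔ last σ ≡ c
    last≡c = mk⇔ (λ e → toℕ-injective (trans e (sym toℕc))) (λ e → trans (cong toℕ e) toℕc)

double-complement≤ : ∀ {d j} → suc d < 2 * j → 2 * (suc d ∸ j) ≤ d
double-complement≤ {d} {j} d+1<2j = begin
  2 * (suc d ∸ j)                ≡⟨ *-distribˡ-∸ 2 (suc d) j ⟩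
  2 * suc d ∸ 2 * j              ≤⟨ ∸-monoʳ-≤ (2 * suc d) d+1<2j ⟩
  2 * suc d ∸ suc (suc d)        ≡⟨ cong (_∸ suc (suc d)) 2[d+1]≡d+2+d ⟩
  suc (suc d) + d ∸ suc (suc d)  ≡⟨ m+n∸m≡n (suc (suc d)) d ⟩
  d                              ∎
  where
  open ≤-Reasoning
  2[d+1]≡d+2+d : 2 * suc d ≡ suc (suc d) + d
  2[d+1]≡d+2+d = trans (*-suc 2 d) (cong (λ x → suc (suc x)) (2*n≡n+n d))

lemma3p5 : ∀ (d j : ℕ) → suc d < 2 * j → j ≤ suc d → AltIncreasing d (Acoeff d j)
lemma3p5 d zero    ()
lemma3p5 d (suc j) d+1<2j _ =
  AltIncreasing-cong (Acoeff≡refinedEulerian d j)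
                     (refinedEulerian-AltIncreasing d (double-complement≤ {d} {suc j} d+1<2j))
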